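{- Let $(D,\sqsubseteq)$ be a dcpo with the Scott topology and let $A\in\mathbf{\Sigma}^0_2(D)$. If $(x_i)_{i\in I}$ is a family whose set of values is directed and whose supremum $x$ lies in $A$, then $x_i\in A$ for all $i$ large enough (i.e. there is $i_0\in I$ such that $x_i\in A$ for all $i\in I$ with $x_{i_0}\sqsubseteq x_i$). In particular, if $D$ is a continuous domain with basis $B\subseteq D$ and $x\in A$, then there exists $b\in B$ with $b\ll x$ and $\{y\in D: b\ll y\sqsubseteq x\}\subseteq A$.
   Context: A dcpo is a poset in which every nonempty directed subset has a supremum; the Scott topology has as open sets the upsets $O$ such that every directed set with supremum in $O$ meets $O$. $\mathbf{\Sigma}^0_2(D)$ is the family of countable unions of Boolean combinations of Scott open sets (equivalently, sets $\bigcup_nU_n\setminus V_n$ with $U_n,V_n$ open). Way-below: $x\ll y$ iff for every directed $S$ with $y\sqsubseteq\sqcup S$ some $s\in S$ satisfies $x\sqsubseteq s$. A set $B\subseteq D$ is a basis if for every $x\in D$, $B\cap\{z:z\ll x\}$ is directed with supremum $x$; $D$ is a continuous domain if it has a basis. -}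

module Defs where

open import Level using (0ℓ)
open import Data.Nat using (ℕ)
open import Data.Product using (Σ; ∃; _×_; _,_)
open import Relation.Nullary using (¬_)
open import Relation.Unary using (Pred; _∈_)
open import Relation.Binary.Bundles using (Poset)

module _ (P : Poset 0ℓ 0ℓ 0ℓ) where
  open Poset P renaming (Carrier to D; _≤_ to _⊑_)

  Subset : Set₁
  Subset = Pred D 0ℓ

  Directed : Subset → Set
  Directed S = (∃ λ x → x ∈ S)
             × (∀ x y → x ∈ S → y ∈ S → ∃ λ z → z ∈ S × x ⊑ z × y ⊑ z)

  IsSup : Subset → D → Set
  IsSup S s = (∀ x → x ∈ S → x ⊑ s)
            × (∀ u → (∀ x → x ∈ S → x ⊑ u) → s ⊑ u)

  IsDCPO : Set₁
  IsDCPO = ∀ (S : Subset) → Directed S → ∃ λ s → IsSup S s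

  IsUpset : Subset → Set
  IsUpset O = ∀ x y → x ⊑ y → x ∈ O → y ∈ O

  IsScottOpen : Subset → Set₁
  IsScottOpen O = IsUpset O
    × (∀ (S : Subset) (s : D) → Directed S → IsSup S s → s ∈ O
         → ∃ λ y → y ∈ S × y ∈ O)

  IsΣ⁰₂ : Subset → Set₁
  IsΣ⁰₂ A = Σ (ℕ → Subset) λ U → Σ (ℕ → Subset) λ V →
      (∀ n → IsScottOpen (U n)) × (∀ n → IsScottOpen (V n))
    × (∀ y → (y ∈ A → ∃ λ n → y ∈ U n × ¬ (y ∈ V n))
           × ((∃ λ n → y ∈ U n × ¬ (y ∈ V n)) → y ∈ A))

  Image : {I : Set} → (I → D) → Subset
  Image {I} f y = ∃ λ (i : I) → f i ≈ y

  _≪_ : D → D → Set₁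
  x ≪ y = ∀ (S : Subset) (s : D) → Directed S → IsSup S s → y ⊑ s
          → ∃ λ z → z ∈ S × x ⊑ z

  -- B is a basis: for each x, B ∩ ↡x is directed with supremum x
  -- (stated via a Set-level predicate equivalent to B ∩ ↡x)
  IsBasis : Subset → Set₁
  IsBasis B = ∀ x → Σ Subset λ W →
      (∀ z → (z ∈ W → z ∈ B × z ≪ x) × (z ∈ B × z ≪ x → z ∈ W))
    × Directed W × IsSup W x

-- A Σ⁰₂ set A is a union of differences U ∖ V of Scott open sets. If the supremum x of a
-- directed set S lies in U ∖ V, Scott openness of U yields some s ∈ S inside U; then every y
-- with s ⊑ y ⊑ x is in U (U is an upset) and not in V (otherwise x would be, V being an upset),
-- so the whole interval [s, x] lies in A. Both parts of the theorem are instances: the values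
-- of a directed family, and the directed set B ∩ ↡x of a basis, using that b ≪ y implies b ⊑ y.
module Submission where

open import Defs
open import Level using (0ℓ)
open import Data.Product using (∃; _×_; _,_; proj₁; proj₂)
open import Relation.Nullary using (¬_)
open import Relation.Unary using (_∈_)
open import Relation.Binary.Bundles using (Poset)

module _ (P : Poset 0ℓ 0ℓ 0ℓ) where
  open Poset P renaming (Carrier to D; _≤_ to _⊑_)

  ↓ : D → Subset P
  ↓ y z = z ⊑ y

  ↓-directed : ∀ y → Directed P (↓ y)
  ↓-directed y = (y , refl) , λ u v u⊑y v⊑y → y , refl , u⊑y , v⊑y

  ↓-sup : ∀ y → IsSup P (↓ y) y
  ↓-sup y = (λ _ z⊑y → z⊑y) , (λ u ub → ub y refl)

  ≪⇒⊑ : ∀ {b y} → _≪_ P b y → b ⊑ y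
  ≪⇒⊑ {b} {y} b≪y with b≪y (↓ y) y (↓-directed y) (↓-sup y) refl
  ... | z , z⊑y , b⊑z = trans b⊑z z⊑y

  upset-difference-convex : ∀ {U V : Subset P} {s x y} → IsUpset P U → IsUpset P V →
    s ∈ U → ¬ x ∈ V → s ⊑ y → y ⊑ x → y ∈ U × ¬ y ∈ V
  upset-difference-convex U-up V-up s∈U x∉V s⊑y y⊑x =
    U-up _ _ s⊑y s∈U , λ y∈V → x∉V (V-up _ _ y⊑x y∈V)

  Σ⁰₂-sup⇒interval⊆ : ∀ {A S x} → IsΣ⁰₂ P A → Directed P S → IsSup P S x → x ∈ A →
    ∃ λ s → s ∈ S × (∀ y → s ⊑ y → y ⊑ x → y ∈ A)
  Σ⁰₂-sup⇒interval⊆ {A} {S} {x} (U , V , U-open , V-open , A≡⋃U∖V) S-dir x-sup x∈A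
    with A≡⋃U∖V x .proj₁ x∈A
  ... | n , x∈U , x∉V with U-open n .proj₂ S x S-dir x-sup x∈U
  ... | s , s∈S , s∈U = s , s∈S , interval⊆A
    where
    interval⊆A : ∀ y → s ⊑ y → y ⊑ x → y ∈ A
    interval⊆A y s⊑y y⊑x = A≡⋃U∖V y .proj₂
      (n , upset-difference-convex (U-open n .proj₁) (V-open n .proj₁) s∈U x∉V s⊑y y⊑x)

  Σ⁰₂-family-eventually-in : ∀ {A} → IsΣ⁰₂ P A → (I : Set) (f : I → D) → Directed P (Image P f) →
    (x : D) → IsSup P (Image P f) x → x ∈ A →
    ∃ λ (i₀ : I) → ∀ (i : I) → f i₀ ⊑ f i → f i ∈ A
  Σ⁰₂-family-eventually-in A-Σ⁰₂ I f f-dir x x-sup x∈A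
    with Σ⁰₂-sup⇒interval⊆ A-Σ⁰₂ f-dir x-sup x∈A
  ... | s , (i₀ , fi₀≈s) , interval⊆A = i₀ , λ i fi₀⊑fi →
    interval⊆A (f i) (trans (reflexive (Eq.sym fi₀≈s)) fi₀⊑fi) (x-sup .proj₁ (f i) (i , Eq.refl))

  Σ⁰₂-basis-element-in : ∀ {A} → IsΣ⁰₂ P A → (B : Subset P) → IsBasis P B → (x : D) → x ∈ A →
    ∃ λ b → b ∈ B × _≪_ P b x × (∀ y → _≪_ P b y → y ⊑ x → y ∈ A)
  Σ⁰₂-basis-element-in A-Σ⁰₂ B B-basis x x∈A with B-basis x
  ... | W , W≡B∩↡x , W-dir , x-sup with Σ⁰₂-sup⇒interval⊆ A-Σ⁰₂ W-dir x-sup x∈A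
  ... | b , b∈W , interval⊆A with W≡B∩↡x b .proj₁ b∈W
  ... | b∈B , b≪x = b , b∈B , b≪x , λ y b≪y y⊑x → interval⊆A y (≪⇒⊑ b≪y) y⊑x

proposition4p4 : (P : Poset 0ℓ 0ℓ 0ℓ) → IsDCPO P → (A : Subset P) → IsΣ⁰₂ P A →
    ((I : Set) (f : I → Poset.Carrier P) → Directed P (Image P f) →
       (x : Poset.Carrier P) → IsSup P (Image P f) x → x ∈ A →
       ∃ λ (i₀ : I) → ∀ (i : I) → Poset._≤_ P (f i₀) (f i) → f i ∈ A)
    × ((B : Subset P) → IsBasis P B → (x : Poset.Carrier P) → x ∈ A →
       ∃ λ b → b ∈ B × _≪_ P b x
         × (∀ y → _≪_ P b y → Poset._≤_ P y x → y ∈ A))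
proposition4p4 P _ A A-Σ⁰₂ =
  Σ⁰₂-family-eventually-in P A-Σ⁰₂ , Σ⁰₂-basis-element-in P A-Σ⁰₂
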